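{- If $T$ is a rotational tournament that is quadrangular and has $|V(T)|>3$, then $O(u)\cap O(v)\neq\emptyset$ for all distinct $u,v\in V(T)$.
   Context: Let $S$ be a set of $k$ integers in $\{1,\dots,2k\}$ such that $i+j\neq 2k+1$ for all $i,j\in S$. The rotational tournament with symbol $S$ has vertices $0,1,\dots,2k$ and an arc $i\rightarrow j$ iff $j-i \pmod{2k+1}\in S$. $O(v)$ is the set of vertices $v$ beats and $I(v)$ the set of vertices beating $v$. A digraph is quadrangular if for all distinct $u,v$, $|O(u)\cap O(v)|\neq 1$ and $|I(u)\cap I(v)|\neq 1$. -}

module Defs where

open import Data.Nat using (ℕ; suc; _+_; _*_; _∸_; _≤_; _<_)
open import Data.Nat.DivMod using (_%_)
open import Data.Fin using (Fin; toℕ)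
open import Data.List using (List; length; filter; allFin)
open import Data.List.Membership.Propositional using (_∈_)
open import Data.List.Membership.DecPropositional (Data.Nat._≟_) using (_∈?_)
open import Data.List.Relation.Unary.Unique.Propositional using (Unique)
open import Data.Product using (_×_)
open import Relation.Binary.PropositionalEquality using (_≡_; _≢_)
open import Relation.Nullary using (Dec; ¬_)
open import Relation.Nullary.Decidable using (_×-dec_)

-- A symbol for the rotational tournament on 2k+1 vertices:
-- a set S (a duplicate-free list) of k integers in {1,…,2k}
-- with i + j ≠ 2k+1 for all i, j ∈ S.
record IsSymbol (k : ℕ) (S : List ℕ) : Set where
  field
    unique  : Unique S
    size    : length S ≡ k
    range   : ∀ {i} → i ∈ S → 1 ≤ i × i ≤ 2 * k
    antisym : ∀ {i j} → i ∈ S → j ∈ S → i + j ≢ suc (2 * k)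

Vertex : ℕ → Set
Vertex k = Fin (suc (2 * k))

-- Arc i → j iff (j − i) mod (2k+1) ∈ S.
Arc : (k : ℕ) → List ℕ → Vertex k → Vertex k → Set
Arc k S i j = ((toℕ j + suc (2 * k)) ∸ toℕ i) % suc (2 * k) ∈ S

arc? : (k : ℕ) (S : List ℕ) (i j : Vertex k) → Dec (Arc k S i j)
arc? k S i j = (((toℕ j + suc (2 * k)) ∸ toℕ i) % suc (2 * k)) ∈? S

commonOut : (k : ℕ) → List ℕ → Vertex k → Vertex k → ℕ
commonOut k S u v = length (filter (λ w → arc? k S u w ×-dec arc? k S v w) (allFin (suc (2 * k))))

commonIn : (k : ℕ) → List ℕ → Vertex k → Vertex k → ℕ
commonIn k S u v = length (filter (λ w → arc? k S w u ×-dec arc? k S w v) (allFin (suc (2 * k))))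

Quadrangular : (k : ℕ) → List ℕ → Set
Quadrangular k S = ∀ (u v : Vertex k) → u ≢ v → commonOut k S u v ≢ 1 × commonIn k S u v ≢ 1

{-# OPTIONS --safe #-}
module Submission where

-- Read the vertices as residues modulo n = 2k + 1, so that i → j iff j − i ∈ S; S contains
-- exactly one of ±a for each a ≢ 0. If u and v had no common out-neighbour, then, with
-- d = u − v (swap u and v to get d ∈ S), S and S + d would be disjoint. Playing this against
-- the partition {S, −S} shows that S is closed under x ↦ x − 2d except at x = d, so the
-- progression g, 2g, … (g = −2d) stays in S until it reaches d = e g, and S lies on it.
-- For e = 1 this gives |S| ≤ 1, i.e. n = 3. Otherwise d is the only common out-neighbour
-- of 0 and (e − 1) g, since (2e + 1) g = 2d + g = 0 rules out every other candidate.

open import Defs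
open import Data.Nat as ℕ using (ℕ; zero; suc; _*_; _<_; _≤_; _∸_; z≤n; s≤s; s≤s⁻¹; _≤?_)
import Data.Nat.Properties as ℕₚ
open import Data.Nat.DivMod using (_%_; m%n<n)
open import Data.Integer using (ℤ; +_; -[1+_]; -_; _+_; _-_; 0ℤ; 1ℤ; _%ℕ_; _/ℕ_)
  renaming (_*_ to _·_)
import Data.Integer.Properties as ℤₚ
open import Data.Integer.DivMod using (n%ℕd<d; a≡a%ℕn+[a/ℕn]*n)
open import Data.Integer.Tactic.RingSolver using (solve; solve-∀)
open import Data.Fin as Fin using (Fin; toℕ; fromℕ; fromℕ<; inject₁; punchOut)
open import Data.Fin.Properties
  using (toℕ-injective; toℕ-fromℕ; toℕ-fromℕ<; toℕ-inject₁; toℕ<n; punchOut-injective; injective⇒≤;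
         any?)
open import Data.List using (List; []; _∷_; length; filter; allFin; lookup)
open import Data.List.Properties using (filter-accept; filter-reject; filter-none)
open import Data.List.Membership.Propositional using (_∈_)
open import Data.List.Membership.Propositional.Properties using (∈-lookup; ∈-allFin)
open import Data.List.Membership.DecPropositional ℕ._≟_ using (_∈?_)
open import Data.List.Relation.Unary.Any using (here; there)
import Data.List.Relation.Unary.All as All
open import Data.List.Relation.Unary.Unique.Propositional using (Unique)
open import Data.List.Relation.Unary.Unique.Propositional.Properties using (allFin⁺)
open import Data.Product using (∃; _×_; _,_; proj₁; proj₂; map₂; swap)
open import Data.Sum as Sum using (_⊎_; inj₁; inj₂; [_,_]′)
open import Function using (_∘_; id; flip)
open import Function.Definitions using (Injective)
open import Level using (0ℓ)
open import Relation.Binary.Core using (Rel; _⇒_)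
open import Relation.Binary.Bundles using (Setoid)
open import Relation.Binary.Definitions using (Reflexive; Decidable)
open import Relation.Binary.Structures using (IsEquivalence)
open import Relation.Binary.PropositionalEquality
  using (_≡_; _≢_; refl; sym; trans; cong; cong₂; subst; module ≡-Reasoning)
import Relation.Binary.Reasoning.Setoid as SetoidReasoning
open import Relation.Nullary using (Dec; yes; no; ¬_; contradiction)
open import Relation.Nullary.Decidable using (_×-dec_; map′; decidable-stable)

module _ {A : Set} where
  open All using (_∷_)
  open import Data.List.Relation.Unary.AllPairs using (_∷_)

  lookup-injective : ∀ {xs : List A} → Unique xs → Injective _≡_ _≡_ (lookup xs)
  lookup-injective (_ ∷ _) {Fin.zero} {Fin.zero} _ = refl
  lookup-injective (x∉xs ∷ _) {Fin.zero} {Fin.suc j} eq =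
    contradiction eq (All.lookup x∉xs (∈-lookup j))
  lookup-injective (x∉xs ∷ _) {Fin.suc i} {Fin.zero} eq =
    contradiction (sym eq) (All.lookup x∉xs (∈-lookup i))
  lookup-injective (_ ∷ u) {Fin.suc i} {Fin.suc j} eq = cong Fin.suc (lookup-injective u eq)

  constant-Unique⇒length≤1 : ∀ {xs : List A} → Unique xs →
                             (∀ {x y} → x ∈ xs → y ∈ xs → x ≡ y) → length xs ≤ 1
  constant-Unique⇒length≤1 {xs = []} _ _ = z≤n
  constant-Unique⇒length≤1 {xs = _ ∷ []} _ _ = s≤s z≤n
  constant-Unique⇒length≤1 {xs = _ ∷ _ ∷ _} ((x≢y ∷ _) ∷ _) const =
    contradiction (const (here refl) (there (here refl))) x≢y

  filter-unique : ∀ {P : A → Set} (P? : ∀ x → Dec (P x)) {xs : List A} {x : A} →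
                  Unique xs → x ∈ xs → P x → (∀ {y} → P y → y ≡ x) → filter P? xs ≡ x ∷ []
  filter-unique P? {x ∷ xs} (x∉xs ∷ _) (here refl) Px only =
    trans (filter-accept P? Px)
          (cong (x ∷_) (filter-none P? (All.map (λ x≢y Py → x≢y (sym (only Py))) x∉xs)))
  filter-unique P? {y ∷ xs} (y∉xs ∷ u) (there x∈xs) Px only =
    trans (filter-reject P? (λ Py → All.lookup y∉xs x∈xs (only Py))) (filter-unique P? u x∈xs Px only)

injective-missing⇒< : ∀ {m n} {f : Fin m → Fin n} (e : Fin n) →
                      Injective _≡_ _≡_ f → (∀ i → f i ≢ e) → m < n
injective-missing⇒< {n = suc _} {f} e f-inj f≢e =
  s≤s (injective⇒≤ {f = λ i → punchOut (f≢e i ∘ sym)}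
                   (f-inj ∘ punchOut-injective (f≢e _ ∘ sym) (f≢e _ ∘ sym)))

m≡m-n+n : ∀ m n → m ≡ m - n + n
m≡m-n+n = solve-∀

m+n-n≡m : ∀ m n → m + n - n ≡ m
m+n-n≡m = solve-∀

m+n-m≡n : ∀ m n → m + n - m ≡ n
m+n-m≡n = solve-∀

m+n-o≡n+[m-o] : ∀ m n o → m + n - o ≡ n + (m - o)
m+n-o≡n+[m-o] = solve-∀

-[m-n]≡n-m : ∀ m n → - (m - n) ≡ n - m
-[m-n]≡n-m = solve-∀

pos-∸ : ∀ {m o} → o ≤ m → + (m ∸ o) ≡ + m - + o
pos-∸ {m} {o} o≤m = sym (trans (ℤₚ.m-n≡m⊖n m o) (ℤₚ.⊖-≥ o≤m))

module Congruence (N : ℤ) where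

  infix 4 _≈_ _≉_

  record _≈_ (a b : ℤ) : Set where
    constructor congruent
    field
      quotient : ℤ
      equation : a ≡ b + quotient · N

  _≉_ : Rel ℤ 0ℓ
  a ≉ b = ¬ a ≈ b

  ≈-reflexive : _≡_ ⇒ _≈_
  ≈-reflexive {a} refl = congruent 0ℤ (sym (ℤₚ.+-identityʳ a))

  ≈-refl : Reflexive _≈_
  ≈-refl = ≈-reflexive refl

  ≈-sym : ∀ {a b} → a ≈ b → b ≈ a
  ≈-sym {a} {b} (congruent q a≡) = congruent (- q) (begin
    b                   ≡⟨ solve (b ∷ q ∷ N ∷ []) ⟩
    b + q · N + - q · N ≡⟨ cong (_+ - q · N) (sym a≡) ⟩
    a + - q · N         ∎)
    where open ≡-Reasoning

  ≈-trans : ∀ {a b c} → a ≈ b → b ≈ c → a ≈ c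
  ≈-trans {a} {b} {c} (congruent q a≡) (congruent r b≡) = congruent (r + q) (begin
    a                   ≡⟨ a≡ ⟩
    b + q · N           ≡⟨ cong (_+ q · N) b≡ ⟩
    c + r · N + q · N   ≡⟨ solve (c ∷ r ∷ q ∷ N ∷ []) ⟩
    c + (r + q) · N     ∎)
    where open ≡-Reasoning

  ≈-isEquivalence : IsEquivalence _≈_
  ≈-isEquivalence = record { refl = ≈-refl ; sym = ≈-sym ; trans = ≈-trans }

  ≈-setoid : Setoid 0ℓ 0ℓ
  ≈-setoid = record { isEquivalence = ≈-isEquivalence }

  module ≈-Reasoning = SetoidReasoning ≈-setoid

  +-cong : ∀ {a b c d} → a ≈ b → c ≈ d → a + c ≈ b + d
  +-cong {a} {b} {c} {d} (congruent q a≡) (congruent r c≡) = congruent (q + r) (begin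
    a + c                     ≡⟨ cong₂ _+_ a≡ c≡ ⟩
    b + q · N + (d + r · N)   ≡⟨ solve (b ∷ d ∷ q ∷ r ∷ N ∷ []) ⟩
    b + d + (q + r) · N       ∎)
    where open ≡-Reasoning

  -‿cong : ∀ {a b} → a ≈ b → - a ≈ - b
  -‿cong {a} {b} (congruent q a≡) = congruent (- q) (begin
    - a            ≡⟨ cong -_ a≡ ⟩
    - (b + q · N)  ≡⟨ solve (b ∷ q ∷ N ∷ []) ⟩
    - b + - q · N  ∎)
    where open ≡-Reasoning

  +N≈ : ∀ a → a + N ≈ a
  +N≈ a = congruent 1ℤ (solve (a ∷ N ∷ []))

  N·≈0 : ∀ a → N · a ≈ 0ℤ
  N·≈0 a = congruent a (solve (a ∷ N ∷ []))

  +-cancelʳ-≈ : ∀ {a b} c → a + c ≈ b + c → a ≈ b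
  +-cancelʳ-≈ {a} {b} c a+c≈b+c = begin
    a          ≡⟨ sym (m+n-n≡m a c) ⟩
    a + c - c  ≈⟨ +-cong a+c≈b+c ≈-refl ⟩
    b + c - c  ≡⟨ m+n-n≡m b c ⟩
    b          ∎
    where open ≈-Reasoning

  -≈0⇒≈ : ∀ {a b} → a - b ≈ 0ℤ → a ≈ b
  -≈0⇒≈ {a} {b} a-b≈0 = begin
    a           ≡⟨ m≡m-n+n a b ⟩
    a - b + b   ≈⟨ +-cong a-b≈0 ≈-refl ⟩
    0ℤ + b      ≡⟨ ℤₚ.+-identityˡ b ⟩
    b           ∎
    where open ≈-Reasoning

  +≈0⇒≈- : ∀ {a b} → a + b ≈ 0ℤ → b ≈ - a
  +≈0⇒≈- {a} {b} a+b≈0 = begin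
    b           ≡⟨ sym (m+n-m≡n a b) ⟩
    a + b - a   ≈⟨ +-cong a+b≈0 ≈-refl ⟩
    0ℤ - a      ≡⟨ ℤₚ.+-identityˡ (- a) ⟩
    - a         ∎
    where open ≈-Reasoning

module Residues (n : ℕ) .{{_ : ℕ.NonZero n}} where

  open Congruence (+ n)

  residue≈ : ∀ a → a ≈ + (a %ℕ n)
  residue≈ a = congruent (a /ℕ n) (a≡a%ℕn+[a/ℕn]*n a n)

  positive-quotient⇒n≤ : ∀ {r s} c → + r ≡ + s + + suc c · + n → n ≤ r
  positive-quotient⇒n≤ {r} {s} c r≡ =
    subst (n ≤_) (sym r≡s+[1+c]n) (ℕₚ.≤-trans (ℕₚ.m≤m+n n (c ℕ.* n)) (ℕₚ.m≤n+m _ s))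
    where
    r≡s+[1+c]n : r ≡ s ℕ.+ suc c ℕ.* n
    r≡s+[1+c]n = ℤₚ.+-injective (trans r≡ (cong (_+_ (+ s)) (sym (ℤₚ.pos-* (suc c) n))))

  residue-injective : ∀ {r s} → r < n → s < n → + r ≈ + s → r ≡ s
  residue-injective _ _ (congruent (+ zero) r≡s) = ℤₚ.+-injective (trans r≡s (ℤₚ.+-identityʳ _))
  residue-injective r<n _ (congruent (+ suc c) r≡) =
    contradiction (positive-quotient⇒n≤ c r≡) (ℕₚ.<⇒≱ r<n)
  residue-injective _ s<n r≈s@(congruent -[1+ c ] _) =
    contradiction (positive-quotient⇒n≤ c (_≈_.equation (≈-sym r≈s))) (ℕₚ.<⇒≱ s<n)

  _≈?_ : Decidable _≈_
  a ≈? b = map′ (λ ra≡rb → ≈-trans (residue≈ a)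
                             (≈-trans (≈-reflexive (cong +_ ra≡rb)) (≈-sym (residue≈ b))))
                (λ a≈b → residue-injective (n%ℕd<d a n) (n%ℕd<d b n)
                           (≈-trans (≈-sym (residue≈ a)) (≈-trans a≈b (residue≈ b))))
                (a %ℕ n ℕ.≟ b %ℕ n)

module RotationalTournament {k : ℕ} {S : List ℕ} (symbol : IsSymbol k S) where

  open IsSymbol symbol

  n : ℕ
  n = suc (2 * k)

  open Congruence (+ n)
  open Residues n
  open ≈-Reasoning

  s<n : ∀ {s} → s ∈ S → s < n
  s<n s∈S = s≤s (proj₂ (range s∈S))

  -- fold x = fold (n ∸ x): fold numbers the k pairs {x, n ∸ x} in [1, 2k] by 0, …, k − 1.
  fold : ℕ → ℕ
  fold x with x ≤? k
  ... | yes _ = ℕ.pred x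
  ... | no  _ = 2 * k ∸ x

  fold< : ∀ {x} → 1 ≤ x → x ≤ 2 * k → fold x < k
  fold< {suc x} _ _ with suc x ≤? k
  ... | yes x<k = x<k
  fold< {suc x} _ x≤2k | no x≰k =
    subst (2 * k ∸ suc x <_) 2k∸k≡k (ℕₚ.∸-monoʳ-< (ℕₚ.≰⇒> x≰k) x≤2k)
    where
    2k∸k≡k : 2 * k ∸ k ≡ k
    2k∸k≡k = trans (ℕₚ.m+n∸m≡n k (k ℕ.+ 0)) (ℕₚ.+-identityʳ k)

  fold-injective : ∀ {a b} → 1 ≤ a → a ≤ 2 * k → 1 ≤ b → b ≤ 2 * k →
                   fold a ≡ fold b → a ≡ b ⊎ a ℕ.+ b ≡ n
  fold-injective {suc a} {suc b} _ a≤2k _ b≤2k eq with suc a ≤? k | suc b ≤? k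
  ... | yes _ | yes _ = inj₁ (cong suc eq)
  ... | yes _ | no  _ = inj₂ (cong suc (trans (cong (ℕ._+ suc b) eq) (ℕₚ.m∸n+n≡m b≤2k)))
  ... | no  _ | yes _ = inj₂ (trans (ℕₚ.+-comm (suc a) (suc b))
                                   (cong suc (trans (cong (ℕ._+ suc a) (sym eq)) (ℕₚ.m∸n+n≡m a≤2k))))
  ... | no  _ | no  _ = inj₁ (ℕₚ.∸-cancelˡ-≡ a≤2k b≤2k eq)

  class : ∀ x → 1 ≤ x × x ≤ 2 * k → Fin k
  class x (1≤x , x≤2k) = fromℕ< (fold< 1≤x x≤2k)

  class-injective : ∀ {a b} pa pb → class a pa ≡ class b pb → a ≡ b ⊎ a ℕ.+ b ≡ n
  class-injective (1≤a , a≤2k) (1≤b , b≤2k) eq =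
    fold-injective 1≤a a≤2k 1≤b b≤2k
      (trans (sym (toℕ-fromℕ< _)) (trans (cong toℕ eq) (toℕ-fromℕ< _)))

  -- Pigeonhole: the k elements of S lie in distinct pairs, so S meets the pair of every r.
  ∈⊎∸∈ : ∀ {r} → 1 ≤ r × r ≤ 2 * k → r ∈ S ⊎ n ∸ r ∈ S
  ∈⊎∸∈ {r} r-range with r ∈? S | n ∸ r ∈? S
  ... | yes r∈S | _          = inj₁ r∈S
  ... | no _    | yes n∸r∈S  = inj₂ n∸r∈S
  ... | no r∉S  | no n∸r∉S   =
    contradiction (injective-missing⇒< (class r r-range) classOf-injective classOf≢r) (ℕₚ.<-irrefl size)
    where
    classOf : Fin (length S) → Fin k
    classOf i = class (lookup S i) (range (∈-lookup i))

    classOf-injective : Injective _≡_ _≡_ classOf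
    classOf-injective {i} {j} eq with class-injective (range (∈-lookup i)) (range (∈-lookup j)) eq
    ... | inj₁ si≡sj   = lookup-injective unique si≡sj
    ... | inj₂ si+sj≡n = contradiction si+sj≡n (antisym (∈-lookup i) (∈-lookup j))

    classOf≢r : ∀ i → classOf i ≢ class r r-range
    classOf≢r i eq with class-injective (range (∈-lookup i)) r-range eq
    ... | inj₁ si≡r   = r∉S (subst (_∈ S) si≡r (∈-lookup i))
    ... | inj₂ si+r≡n =
      n∸r∉S (subst (_∈ S) (trans (sym (ℕₚ.m+n∸n≡m _ r)) (cong (_∸ r) si+r≡n)) (∈-lookup i))

  InS : ℤ → Set
  InS a = ∃ λ s → s ∈ S × a ≈ + s

  InS-resp : ∀ {a b} → a ≈ b → InS a → InS b
  InS-resp a≈b (s , s∈S , a≈s) = s , s∈S , ≈-trans (≈-sym a≈b) a≈s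

  -≈n∸ : ∀ {r} → r ≤ n → - + r ≈ + (n ∸ r)
  -≈n∸ {r} r≤n = begin
    - + r        ≈⟨ ≈-sym (+N≈ (- + r)) ⟩
    - + r + + n  ≡⟨ ℤₚ.+-comm (- + r) (+ n) ⟩
    + n - + r    ≡⟨ sym (pos-∸ r≤n) ⟩
    + (n ∸ r)    ∎

  InS-antisym : ∀ {a b} → InS a → InS b → a + b ≉ 0ℤ
  InS-antisym (s , s∈S , a≈s) (t , t∈S , b≈t) a+b≈0 = antisym s∈S t∈S s+t≡n
    where
    s≤n : s ≤ n
    s≤n = ℕₚ.<⇒≤ (s<n s∈S)

    t≈n∸s : + t ≈ + (n ∸ s)
    t≈n∸s = begin
      + t        ≈⟨ +≈0⇒≈- (≈-trans (+-cong (≈-sym a≈s) (≈-sym b≈t)) a+b≈0) ⟩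
      - + s      ≈⟨ -≈n∸ s≤n ⟩
      + (n ∸ s)  ∎

    s+t≡n : s ℕ.+ t ≡ n
    s+t≡n = trans (cong (s ℕ.+_) (residue-injective (s<n t∈S) n∸s<n t≈n∸s)) (ℕₚ.m+[n∸m]≡n s≤n)
      where
      n∸s<n : n ∸ s < n
      n∸s<n = ℕₚ.∸-monoʳ-< (proj₁ (range s∈S)) s≤n

  InS-nonzero : ∀ {a} → InS a → a ≉ 0ℤ
  InS-nonzero a∈S a≈0 = InS-antisym a∈S a∈S (+-cong a≈0 a≈0)

  InS-total : ∀ {a} → a ≉ 0ℤ → InS a ⊎ InS (- a)
  InS-total {a} a≉0 =
    Sum.map (λ r∈S → r , r∈S , residue≈ a)
            (λ n∸r∈S → n ∸ r , n∸r∈S , ≈-trans (-‿cong (residue≈ a)) (-≈n∸ (ℕₚ.<⇒≤ r<n)))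
            (∈⊎∸∈ (ℕₚ.n≢0⇒n>0 r≢0 , s≤s⁻¹ r<n))
    where
    r : ℕ
    r = a %ℕ n
    r<n : r < n
    r<n = n%ℕd<d a n
    r≢0 : r ≢ 0
    r≢0 r≡0 = a≉0 (≈-trans (residue≈ a) (≈-reflexive (cong +_ r≡0)))

  InS-neg : ∀ {a} → a ≉ 0ℤ → ¬ InS a → InS (- a)
  InS-neg a≉0 a∉S = [ flip contradiction a∉S , id ]′ (InS-total a≉0)

  ⟦_⟧ : Vertex k → ℤ
  ⟦ v ⟧ = + toℕ v

  vertex : ℤ → Vertex k
  vertex a = fromℕ< (n%ℕd<d a n)

  ⟦vertex⟧ : ∀ a → ⟦ vertex a ⟧ ≈ a
  ⟦vertex⟧ a = begin
    ⟦ vertex a ⟧  ≡⟨ cong +_ (toℕ-fromℕ< (n%ℕd<d a n)) ⟩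
    + (a %ℕ n)    ≈⟨ ≈-sym (residue≈ a) ⟩
    a             ∎

  ⟦⟧-injective : ∀ {u v} → ⟦ u ⟧ ≈ ⟦ v ⟧ → u ≡ v
  ⟦⟧-injective {u} {v} = toℕ-injective ∘ residue-injective (toℕ<n u) (toℕ<n v)

  arc-offset : ∀ i j → ⟦ j ⟧ - ⟦ i ⟧ ≈ + ((toℕ j ℕ.+ n ∸ toℕ i) % n)
  arc-offset i j = begin
    ⟦ j ⟧ - ⟦ i ⟧                   ≈⟨ +-cong (≈-sym (+N≈ ⟦ j ⟧)) (≈-refl { - ⟦ i ⟧}) ⟩
    ⟦ j ⟧ + + n - ⟦ i ⟧             ≡⟨ sym (pos-∸ i≤j+n) ⟩
    + (toℕ j ℕ.+ n ∸ toℕ i)         ≈⟨ residue≈ _ ⟩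
    + ((toℕ j ℕ.+ n ∸ toℕ i) % n)  ∎
    where
    i≤j+n : toℕ i ≤ toℕ j ℕ.+ n
    i≤j+n = ℕₚ.≤-trans (ℕₚ.<⇒≤ (toℕ<n i)) (ℕₚ.m≤n+m n (toℕ j))

  Arc⇒InS : ∀ i j → Arc k S i j → InS (⟦ j ⟧ - ⟦ i ⟧)
  Arc⇒InS i j i→j = _ , i→j , arc-offset i j

  InS⇒Arc : ∀ i j → InS (⟦ j ⟧ - ⟦ i ⟧) → Arc k S i j
  InS⇒Arc i j (s , s∈S , j-i≈s) = subst (_∈ S) (sym offset≡s) s∈S
    where
    offset≡s : (toℕ j ℕ.+ n ∸ toℕ i) % n ≡ s
    offset≡s = residue-injective (m%n<n (toℕ j ℕ.+ n ∸ toℕ i) n) (s<n s∈S)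
                                 (≈-trans (≈-sym (arc-offset i j)) j-i≈s)

  module DisjointShift {d : ℤ} (d∈S : InS d) (disjoint : ∀ {x} → InS x → ¬ InS (x + d)) where

    g : ℤ
    g = - (d + d)

    disjoint⁻ : ∀ {x} → InS x → ¬ InS (x - d)
    disjoint⁻ {x} x∈S x-d∈S = disjoint x-d∈S (InS-resp (≈-reflexive (m≡m-n+n x d)) x∈S)

    g∈S : InS g
    g∈S = InS-neg (InS-antisym d∈S d∈S) (disjoint d∈S)

    -- x − d ∉ S, so d − x ∈ S; then 2d − x ∉ S, so x − 2d ∈ S.
    step : ∀ {x} → InS x → x ≉ d → InS (x + g)
    step {x} x∈S x≉d = InS-resp x-2d≈x+g (InS-neg 2d-x≉0 (disjoint d-x∈S))
      where
      x-2d≈x+g : - (- (x - d) + d) ≈ x + - (d + d)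
      x-2d≈x+g = ≈-reflexive (solve (x ∷ d ∷ []))

      d-x∈S : InS (- (x - d))
      d-x∈S = InS-neg (x≉d ∘ -≈0⇒≈) (disjoint⁻ x∈S)

      2d-x≉0 : - (x - d) + d ≉ 0ℤ
      2d-x≉0 2d-x≈0 = disjoint d∈S (InS-resp x≈2d x∈S)
        where
        x≈2d : x ≈ d + d
        x≈2d = ≈-sym (-≈0⇒≈ {d + d} {x} (begin
          d + d - x      ≡⟨ solve (x ∷ d ∷ []) ⟩
          - (x - d) + d  ≈⟨ 2d-x≈0 ⟩
          0ℤ             ∎))

    progression : ℕ → ℤ
    progression j = + suc j · g

    progression-zero : progression 0 ≡ g
    progression-zero = ℤₚ.*-identityˡ g

    progression-suc : ∀ j → progression (suc j) ≡ g + progression j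
    progression-suc j = ℤₚ.suc-* (+ suc j) g

    progression-antipodal : ∀ i j {m} → i ℕ.+ j ≡ m →
      progression (suc i) + progression m + progression (suc j) ≡
      progression (suc m) + progression (suc m) + g
    progression-antipodal i j refl = identity (+ i) (+ j) g
      where
      identity : ∀ a b g →
        (+ 1 + (+ 1 + a)) · g + (+ 1 + (a + b)) · g + (+ 1 + (+ 1 + b)) · g ≡
        (+ 1 + (+ 1 + (a + b))) · g + (+ 1 + (+ 1 + (a + b))) · g + g
      identity = solve-∀

    Prefix⊆S : ℕ → Set
    Prefix⊆S m = ∀ {j} → j ≤ m → InS (progression j)

    prefix-extend : ∀ {m} → Prefix⊆S m → InS (progression (suc m)) → Prefix⊆S (suc m)
    prefix-extend prefix next j≤1+m with ℕₚ.m≤n⇒m<n∨m≡n j≤1+m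
    ... | inj₁ j<1+m = prefix (s≤s⁻¹ j<1+m)
    ... | inj₂ refl  = next

    Reaches : ℕ → Set
    Reaches e = progression e ≈ d × Prefix⊆S e

    prefix-or-reaches : ∀ m → Prefix⊆S m ⊎ ∃ Reaches
    prefix-or-reaches zero = inj₁ λ { z≤n → InS-resp (≈-reflexive (sym progression-zero)) g∈S }
    prefix-or-reaches (suc m) with prefix-or-reaches m
    ... | inj₂ reaches = inj₂ reaches
    ... | inj₁ prefix with progression m ≈? d
    ...   | yes hit  = inj₂ (m , hit , prefix)
    ...   | no  miss = inj₁ (prefix-extend prefix (InS-resp next≈ (step (prefix ℕₚ.≤-refl) miss)))
      where
      next≈ : progression m + g ≈ progression (suc m)
      next≈ = ≈-reflexive (trans (ℤₚ.+-comm (progression m) g) (sym (progression-suc m)))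

    reaches : ∃ Reaches
    reaches = [ (λ prefix → contradiction (N·≈0 g) (InS-nonzero (prefix ℕₚ.≤-refl))) , id ]′
                (prefix-or-reaches (2 * k))

    module Reaching (e : ℕ) (hit : progression e ≈ d) where

      InProgression : ℤ → Set
      InProgression x = ∃ λ (j : Fin (suc e)) → x ≈ progression (toℕ j)

      Outside : ℤ → Set
      Outside x = InS x × ¬ InProgression x

      outside-step : ∀ {x} → Outside x → Outside (x + g)
      outside-step {x} (x∈S , x∉P) = step x∈S x≉d , x+g∉P
        where
        x≉d : x ≉ d
        x≉d x≈d = x∉P (fromℕ e , (begin
          x                             ≈⟨ x≈d ⟩
          d                             ≈⟨ ≈-sym hit ⟩
          progression e                 ≡⟨ cong progression (sym (toℕ-fromℕ e)) ⟩
          progression (toℕ (fromℕ e))   ∎))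

        x+g∉P : ¬ InProgression (x + g)
        x+g∉P (Fin.zero , x+g≈g) = InS-nonzero x∈S (+-cancelʳ-≈ g (begin
          x + g          ≈⟨ x+g≈g ⟩
          progression 0  ≡⟨ progression-zero ⟩
          g              ≡⟨ sym (ℤₚ.+-identityˡ g) ⟩
          0ℤ + g         ∎))
        x+g∉P (Fin.suc j , x+g≈) = x∉P (inject₁ j , +-cancelʳ-≈ g (begin
          x + g                              ≈⟨ x+g≈ ⟩
          progression (suc (toℕ j))          ≡⟨ progression-suc (toℕ j) ⟩
          g + progression (toℕ j)            ≡⟨ ℤₚ.+-comm g _ ⟩
          progression (toℕ j) + g            ≡⟨ cong (λ i → progression i + g) (sym (toℕ-inject₁ j)) ⟩
          progression (toℕ (inject₁ j)) + g  ∎))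

      outside-walk : ∀ {x} → Outside x → ∀ j → Outside (x + progression j)
      outside-walk {x} x-out zero = subst Outside (cong (_+_ x) (sym progression-zero)) (outside-step x-out)
      outside-walk {x} x-out (suc j) = subst Outside x+p+g≡ (outside-step (outside-walk x-out j))
        where
        x+p+g≡ : x + progression j + g ≡ x + progression (suc j)
        x+p+g≡ = trans (ℤₚ.+-assoc x (progression j) g)
                       (cong (_+_ x) (trans (ℤₚ.+-comm (progression j) g) (sym (progression-suc j))))

      -- Off the progression S is closed under + g, so e + 1 steps from such an x lead to x + d ∈ S.
      S⊆progression : ∀ {x} → InS x → InProgression x
      S⊆progression {x} x∈S = decidable-stable (any? λ j → x ≈? progression (toℕ j)) λ x∉P →
        disjoint x∈S (InS-resp (+-cong (≈-refl {x}) hit) (proj₁ (outside-walk (x∈S , x∉P) e)))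

    k≤1 : progression 0 ≈ d → k ≤ 1
    k≤1 hit = subst (_≤ 1) size (constant-Unique⇒length≤1 unique λ s∈S t∈S →
      residue-injective (s<n s∈S) (s<n t∈S) (≈-trans (≈g s∈S) (≈-sym (≈g t∈S))))
      where
      open Reaching 0 hit

      InProgression⇒≈g : ∀ {x} → InProgression x → x ≈ progression 0
      InProgression⇒≈g (Fin.zero , x≈g) = x≈g

      ≈g : ∀ {s} → s ∈ S → + s ≈ progression 0
      ≈g s∈S = InProgression⇒≈g (S⊆progression (_ , s∈S , ≈-refl))

    module CommonOut (m : ℕ) (hit : progression (suc m) ≈ d) (prefix : Prefix⊆S (suc m)) where

      open Reaching (suc m) hit

      v w₀ : Vertex k
      v = vertex (progression m)
      w₀ = vertex d

      ⟦v⟧≈ : ⟦ v ⟧ ≈ progression m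
      ⟦v⟧≈ = ⟦vertex⟧ (progression m)

      ⟦w₀⟧≈ : ⟦ w₀ ⟧ ≈ d
      ⟦w₀⟧≈ = ⟦vertex⟧ d

      -- With j + r = m the three terms have total coefficient 2 (m + 2) + 1, and (m + 2) g ≈ d.
      no-wraparound : ∀ {i j} → i ≤ suc m → j ≤ m → progression i ≉ progression (suc j) + progression m
      no-wraparound {i} {j} i≤1+m j≤m i≈ = InS-antisym (prefix i≤1+m) (prefix 1+r≤1+m) (begin
        progression i + progression (suc r)                        ≈⟨ +-cong i≈ (≈-refl {progression (suc r)}) ⟩
        progression (suc j) + progression m + progression (suc r)  ≡⟨ progression-antipodal j r j+r≡m ⟩
        progression (suc m) + progression (suc m) + g              ≈⟨ +-cong (+-cong hit hit) (≈-refl {g}) ⟩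
        d + d + g                                                  ≡⟨ ℤₚ.+-inverseʳ (d + d) ⟩
        0ℤ                                                         ∎)
        where
        r : ℕ
        r = proj₁ (ℕₚ.m≤n⇒∃[o]m+o≡n j≤m)
        j+r≡m : j ℕ.+ r ≡ m
        j+r≡m = proj₂ (ℕₚ.m≤n⇒∃[o]m+o≡n j≤m)
        1+r≤1+m : suc r ≤ suc m
        1+r≤1+m = s≤s (subst (r ≤_) j+r≡m (ℕₚ.m≤n+m r j))

      w₀-common-out : Arc k S Fin.zero w₀ × Arc k S v w₀
      w₀-common-out = InS⇒Arc Fin.zero w₀ (InS-resp d≈ d∈S) , InS⇒Arc v w₀ (InS-resp g≈ g∈S)
        where
        d≈ : d ≈ ⟦ w₀ ⟧ - ⟦ Fin.zero {2 * k} ⟧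
        d≈ = begin
          d                              ≈⟨ ≈-sym ⟦w₀⟧≈ ⟩
          ⟦ w₀ ⟧                         ≡⟨ sym (ℤₚ.+-identityʳ _) ⟩
          ⟦ w₀ ⟧ - ⟦ Fin.zero {2 * k} ⟧  ∎

        g≈ : g ≈ ⟦ w₀ ⟧ - ⟦ v ⟧
        g≈ = begin
          g                                    ≡⟨ sym (m+n-n≡m g (progression m)) ⟩
          g + progression m - progression m    ≡⟨ cong (_- progression m) (sym (progression-suc m)) ⟩
          progression (suc m) - progression m  ≈⟨ +-cong (≈-trans hit (≈-sym ⟦w₀⟧≈)) (-‿cong (≈-sym ⟦v⟧≈)) ⟩
          ⟦ w₀ ⟧ - ⟦ v ⟧                        ∎

      common-out⇒≡w₀ : ∀ {w} → Arc k S Fin.zero w × Arc k S v w → w ≡ w₀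
      common-out⇒≡w₀ {w} (0→w , v→w) =
        from-progression (S⊆progression w∈S) (S⊆progression (Arc⇒InS v w v→w))
        where
        w∈S : InS ⟦ w ⟧
        w∈S = InS-resp (≈-reflexive (ℤₚ.+-identityʳ ⟦ w ⟧)) (Arc⇒InS Fin.zero w 0→w)

        ⟦w⟧≈ : ∀ {y} → ⟦ w ⟧ - ⟦ v ⟧ ≈ y → ⟦ w ⟧ ≈ y + progression m
        ⟦w⟧≈ {y} w-v≈y = begin
          ⟦ w ⟧                  ≡⟨ m≡m-n+n ⟦ w ⟧ ⟦ v ⟧ ⟩
          ⟦ w ⟧ - ⟦ v ⟧ + ⟦ v ⟧  ≈⟨ +-cong w-v≈y ⟦v⟧≈ ⟩
          y + progression m      ∎

        from-progression : InProgression ⟦ w ⟧ → InProgression (⟦ w ⟧ - ⟦ v ⟧) → w ≡ w₀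
        from-progression _ (Fin.zero , w-v≈) = ⟦⟧-injective (begin
          ⟦ w ⟧                          ≈⟨ ⟦w⟧≈ w-v≈ ⟩
          progression 0 + progression m  ≡⟨ cong (_+ progression m) progression-zero ⟩
          g + progression m              ≡⟨ sym (progression-suc m) ⟩
          progression (suc m)            ≈⟨ hit ⟩
          d                              ≈⟨ ≈-sym ⟦w₀⟧≈ ⟩
          ⟦ w₀ ⟧                         ∎)
        from-progression (i , w≈) (Fin.suc j , w-v≈) =
          contradiction (≈-trans (≈-sym w≈) (⟦w⟧≈ w-v≈))
                        (no-wraparound (s≤s⁻¹ (toℕ<n i)) (s≤s⁻¹ (toℕ<n j)))

      unique-common-out : commonOut k S Fin.zero v ≡ 1
      unique-common-out =
        cong length (filter-unique (λ w → arc? k S Fin.zero w ×-dec arc? k S v w)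
                                   (allFin⁺ n) (∈-allFin w₀) w₀-common-out common-out⇒≡w₀)

      0≢v : Fin.zero ≢ v
      0≢v 0≡v = InS-nonzero (prefix (ℕₚ.n≤1+n m)) (begin
        progression m  ≈⟨ ≈-sym ⟦v⟧≈ ⟩
        ⟦ v ⟧          ≡⟨ cong ⟦_⟧ (sym 0≡v) ⟩
        0ℤ             ∎)

    not-quadrangular : 2 ≤ k → ¬ Quadrangular k S
    not-quadrangular 2≤k quad = unreachable reaches
      where
      unreachable : ¬ ∃ Reaches
      unreachable (zero , hit , _) = ℕₚ.<⇒≱ 2≤k (k≤1 hit)
      unreachable (suc m , hit , prefix) = proj₁ (quad Fin.zero v 0≢v) unique-common-out
        where open CommonOut m hit prefix

  common-out-neighbour : ∀ u v → 2 ≤ k → Quadrangular k S → InS (⟦ u ⟧ - ⟦ v ⟧) →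
                         ∃ λ w → Arc k S u w × Arc k S v w
  common-out-neighbour u v 2≤k quad u-v∈S =
    decidable-stable (any? λ w → arc? k S u w ×-dec arc? k S v w) λ none →
      DisjointShift.not-quadrangular u-v∈S (disjoint none) 2≤k quad
    where
    disjoint : ¬ (∃ λ w → Arc k S u w × Arc k S v w) →
               ∀ {x} → InS x → ¬ InS (x + (⟦ u ⟧ - ⟦ v ⟧))
    disjoint none {x} x∈S x+u-v∈S =
      none (w , InS⇒Arc u w (InS-resp x≈w-u x∈S) , InS⇒Arc v w (InS-resp x+u-v≈w-v x+u-v∈S))
      where
      w : Vertex k
      w = vertex (⟦ u ⟧ + x)
      x≈w-u : x ≈ ⟦ w ⟧ - ⟦ u ⟧
      x≈w-u = begin
        x                  ≡⟨ sym (m+n-m≡n ⟦ u ⟧ x) ⟩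
        ⟦ u ⟧ + x - ⟦ u ⟧  ≈⟨ +-cong (≈-sym (⟦vertex⟧ (⟦ u ⟧ + x))) (≈-refl { - ⟦ u ⟧}) ⟩
        ⟦ w ⟧ - ⟦ u ⟧      ∎
      x+u-v≈w-v : x + (⟦ u ⟧ - ⟦ v ⟧) ≈ ⟦ w ⟧ - ⟦ v ⟧
      x+u-v≈w-v = begin
        x + (⟦ u ⟧ - ⟦ v ⟧)  ≡⟨ sym (m+n-o≡n+[m-o] ⟦ u ⟧ x ⟦ v ⟧) ⟩
        ⟦ u ⟧ + x - ⟦ v ⟧    ≈⟨ +-cong (≈-sym (⟦vertex⟧ (⟦ u ⟧ + x))) (≈-refl { - ⟦ v ⟧}) ⟩
        ⟦ w ⟧ - ⟦ v ⟧        ∎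

  common-out : ∀ {u v} → 2 ≤ k → Quadrangular k S → u ≢ v → ∃ λ w → Arc k S u w × Arc k S v w
  common-out {u} {v} 2≤k quad u≢v =
    [ common-out-neighbour u v 2≤k quad
    , map₂ swap ∘ common-out-neighbour v u 2≤k quad
                ∘ InS-resp (≈-reflexive (-[m-n]≡n-m ⟦ u ⟧ ⟦ v ⟧))
    ]′ (InS-total (u≢v ∘ ⟦⟧-injective ∘ -≈0⇒≈))

3<1+2k⇒2≤k : ∀ {k} → 3 < suc (2 * k) → 2 ≤ k
3<1+2k⇒2≤k {zero} (s≤s ())
3<1+2k⇒2≤k {suc zero} (s≤s (s≤s (s≤s ())))
3<1+2k⇒2≤k {suc (suc _)} _ = s≤s (s≤s z≤n)

corollary19 : (k : ℕ) (S : List ℕ) → IsSymbol k S → Quadrangular k S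
              → 3 < suc (2 * k)
              → ∀ (u v : Vertex k) → u ≢ v → ∃ λ w → Arc k S u w × Arc k S v w
corollary19 k S symbol quad 3<n u v = RotationalTournament.common-out symbol (3<1+2k⇒2≤k 3<n) quad
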